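{- Let $\mathcal{L}$, $\mathcal{C}$, $\mathcal{M}$, the types $\sigma_C,\rho_C$, $\sigma_M,\rho^1_M,\rho^2_M$, the sets $L_M$ and the repository $\Delta^{\mathcal{C},\mathcal{M}}_{\mathcal{L}}$ be as in the context. Let $\Gamma$ be a finite basis with $\Gamma\subseteq\{x_C:\sigma_C\to\rho_C\mid C\in\mathcal{C}\}\cup\{x^{\rho}_M:(\sigma_M\to\rho\cap\rho^1_M)\to(\sigma_M\to\rho+\rho^2_M)\mid M\in\mathcal{M},\ \rho\in\mathbb{T}_R,\ [\![\rho]\!]\text{ defined}\}$ (where the $x_C$, $x^\rho_M$ are distinct term variables), and let $\sigma\in\mathbb{T}$, $\rho\in\mathbb{T}_R$ be such that $[\![\sigma\to\rho]\!]$ is defined. Let $k=\max(\{\mathrm{level}([\![\rho_C]\!])\mid C\in\mathcal{C}\}\cup\{\mathrm{level}([\![\rho^2_M]\!])\mid M\in\mathcal{M}\}\cup\{\mathrm{level}([\![\rho]\!])\})$. Let $M_1,\ldots,M_n\in\mathcal{M}$. If $\Gamma\vdash x_C\triangleright x^{\rho_1}_{M_1}\triangleright\cdots\triangleright x^{\rho_n}_{M_n}:\sigma\to\rho$ in the $\Lambda_R$ type assignment system, then $\Delta^{\mathcal{C},\mathcal{M}}_{\mathcal{L}}\vdash_k C\triangleright M_1\triangleright\cdots\triangleright M_n:[\![\sigma\to\rho]\!]$ in $\mathsf{BCL}_k(\mathbb{T}_C)$.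
   Context: Notation: $x\triangleright f$ denotes $f\,x$, left associative, so $e\triangleright f_1\triangleright\cdots\triangleright f_n$ denotes $f_n(\cdots(f_1\,e)\cdots)$. $\Lambda_R$ terms: $M,N::=x\mid \lambda x.M\mid MN\mid M.l\mid R\mid M\oplus R$, records $R::=\langle l_i=M_i\mid i\in I\rangle$ ($I$ finite, labels distinct); $\mathrm{lbl}(\langle l_i=M_i\mid i\in I\rangle)=\{l_i\mid i\in I\}$. $\mathbf{Y}=\lambda f.(\lambda x.f(xx))(\lambda x.f(xx))$. Types $\mathbb{T}$: $\sigma::=a\mid\omega\mid\sigma\to\sigma\mid\sigma\cap\sigma\mid\rho$; record types $\mathbb{T}_R$: $\rho::=\langle\rangle\mid\langle l:\sigma\rangle\mid\rho+\rho\mid\rho\cap\rho$. Subtyping $\le$ is the least preorder with: $\sigma\le\omega$; $\omega\le\omega\to\omega$; $\sigma\cap\tau\le\sigma$; $\sigma\cap\tau\le\tau$; $\sigma\le\tau_1,\sigma\le\tau_2\Rightarrow\sigma\le\tau_1\cap\tau_2$; $(\sigma\to\tau_1)\cap(\sigma\to\tau_2)\le\sigma\to\tau_1\cap\tau_2$; $\sigma_2\le\sigma_1,\tau_1\le\tau_2\Rightarrow\sigma_1\to\tau_1\le\sigma_2\to\tau_2$; $\langle l:\sigma\rangle\le\langle\rangle$; $\langle l:\sigma\rangle\cap\langle l:\tau\rangle\le\langle l:\sigma\cap\tau\rangle$; $\sigma\le\tau\Rightarrow\langle l:\sigma\rangle\le\langle l:\tau\rangle$; and, writing $\sigma=\tau$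 for mutual $\le$: $\rho+\langle\rangle=\langle\rangle+\rho=\rho$; $(\rho_1+\rho_2)+\rho_3=\rho_1+(\rho_2+\rho_3)$; $(\rho_1\cap\rho_2)+\rho_3=(\rho_1+\rho_3)\cap(\rho_2+\rho_3)$; $\langle l:\sigma\rangle+(\langle l:\tau\rangle\cap\rho)=\langle l:\tau\rangle\cap\rho$; $\langle l:\sigma\rangle+(\langle l':\tau\rangle\cap\rho)=\langle l':\tau\rangle\cap(\langle l:\sigma\rangle+\rho)$ if $l\ne l'$; $\rho_1\le\rho_2\Rightarrow\rho_1+\rho\le\rho_2+\rho$; $\rho_1=\rho_2\Rightarrow\rho+\rho_1=\rho+\rho_2$. For record types $\mathrm{lbl}(\langle\rangle)=\emptyset$, $\mathrm{lbl}(\langle l:\sigma\rangle)=\{l\}$, $\mathrm{lbl}(\rho_1\cap\rho_2)=\mathrm{lbl}(\rho_1+\rho_2)=\mathrm{lbl}(\rho_1)\cup\mathrm{lbl}(\rho_2)$. Type assignment for $\Lambda_R$ (bases are finite sets of $x:\sigma$ with distinct variables): axiom $x:\sigma\in\Gamma\Rightarrow\Gamma\vdash x:\sigma$; $\to$-intro and $\to$-elim; $\cap$-intro; $\Gamma\vdash M:\omega$; subsumption along $\le$; $\Gamma\vdash\langle l_i=M_i\mid i\in I\rangle:\langle\rangle$; from $\Gamma\vdash M_k:\sigma$, $k\in I$ infer $\Gamma\vdash\langle l_i=M_i\mid i\in I\rangle:\langle l_k:\sigma\rangle$; from $\Gamma\vdash M:\langle l:\sigma\rangle$ infer $\Gamma\vdash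 M.l:\sigma$; from $\Gamma\vdash M:\rho_1$, $\Gamma\vdash R:\rho_2$, $\mathrm{lbl}(R)=\mathrm{lbl}(\rho_2)$ infer $\Gamma\vdash M\oplus R:\rho_1+\rho_2$. $\mathsf{BCL}_k(\mathbb{T}_C)$: types $\tau::=a\mid\alpha\mid\omega\mid\tau\to\tau\mid\tau\cap\tau\mid c(\tau)$; subtyping: the arrow/intersection/$\omega$ axioms above plus $\tau_1\le\tau_2\Rightarrow c(\tau_1)\le c(\tau_2)$ and $c(\tau_1)\cap c(\tau_2)\le c(\tau_1\cap\tau_2)$. Level: $0$ for $\omega,a,\alpha$; $\mathrm{level}(c(\tau))=1+\mathrm{level}(\tau)$; $\mathrm{level}(\sigma\to\tau)=1+\max$; $\mathrm{level}(\sigma\cap\tau)=\max$. Substitutions $S$ map type variables to types; $\mathrm{level}(S)=\max_{\alpha\in\mathrm{dom}(S)}\mathrm{level}(S(\alpha))$. Repository $\Delta$: finite set of $C:\tau$; combinatory terms $E::=C\mid(E\,E')$. Rules: $C:\tau\in\Delta,\ \mathrm{level}(S)\le k\Rightarrow\Delta\vdash_k C:S(\tau)$; $\to$-elim; $\cap$-intro; subsumption. Translation: finite label set $\mathcal{L}$, unary constructors $\mathrm{rec}$ and $l$ ($l\in\mathcal{L}$); partial map $[\![\omega]\!]=\omega$, $[\![a]\!]=a$, $[\![\sigma\to\tau]\!]=[\![\sigma]\!]\to[\![\tau]\!]$, $[\![\sigma\cap\tau]\!]=[\![\sigma]\!]\cap[\![\tau]\!]$, $[\![\langle l:\tau\rangle]\!]=\mathrm{rec}(l([\![\tau]\!]))$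 ($l\in\mathcal{L}$), $[\![\langle\rangle]\!]=\mathrm{rec}(\omega)$, undefined otherwise (in particular on types containing $+$). Setting: $\mathcal{C}$ finite set of classes (closed terms $\mathbf{Y}(\lambda\mathit{myClass}.\lambda\mathit{state}.\langle l_i=N_i\mid i\in I\rangle)$) with types $\sigma_C,\rho_C$, $[\![\sigma_C\to\rho_C]\!]$ defined and $\vdash C:\sigma_C\to\rho_C$. $\mathcal{M}$ finite set of mixins (closed terms $\lambda\mathit{argClass}.\mathbf{Y}(\lambda\mathit{myClass}.\lambda\mathit{state}.(\mathit{argClass}\;\mathit{state})\oplus R_M)$) with types $\sigma_M,\rho^1_M,\rho^2_M$, all with defined translation, and $\vdash M:(\sigma_M\to\rho\cap\rho^1_M)\to(\sigma_M\to\rho+\rho^2_M)$ for all $\rho\in\mathbb{T}_R$; $L_M=\mathrm{lbl}(\rho^2_M)=\mathrm{lbl}(R_M)\subseteq\mathcal{L}$ non-empty. Repository $\Delta^{\mathcal{C},\mathcal{M}}_{\mathcal{L}}=\{C:[\![\sigma_C\to\rho_C]\!]\mid C\in\mathcal{C}\}\cup\{M:((\,[\![\sigma_M]\!]\to[\![\rho^1_M]\!])\to([\![\sigma_M]\!]\to[\![\rho^2_M]\!]))\cap\bigcap_{l\in\mathcal{L}\setminus L_M}((\,[\![\sigma_M]\!]\to\mathrm{rec}(l(\alpha_l)))\to([\![\sigma_M]\!]\to\mathrm{rec}(l(\alpha_l))))\mid M\in\mathcal{M}\}$ with distinct type variables $\alpha_l$. -}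

module Defs where

open import Data.Nat using (ℕ; zero; suc; _⊔_) renaming (_≤_ to _≤ℕ_)
open import Data.Nat.Properties using (_≟_)
open import Data.Bool using (true; false)
open import Data.List using (List; []; _∷_; map; foldl; foldr; filter; _++_; allFin)
open import Data.List.Membership.Propositional using (_∈_; _∉_)
open import Data.List.Membership.DecPropositional _≟_ using (_∈?_; _∉?_)
open import Data.List.Relation.Unary.All using (All)
open import Data.List.Relation.Unary.Unique.Propositional using (Unique)
open import Data.Product using (Σ; ∃; _×_; _,_; proj₁; proj₂)
open import Data.Sum using (_⊎_)
open import Data.Unit using (⊤)
open import Data.Fin using (Fin)
open import Data.Maybe using (Maybe; just; nothing)
open import Relation.Nullary using (¬_; ¬?; yes; no)
open import Relation.Binary.PropositionalEquality using (_≡_; _≢_)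
open import Function using (_∘_; Injective)

Label Var Atom TVar : Set
Label = ℕ
Var   = ℕ
Atom  = ℕ
TVar  = ℕ

SameSet : List ℕ → List ℕ → Set
SameSet xs ys = ∀ l → (l ∈ xs → l ∈ ys) × (l ∈ ys → l ∈ xs)

-- Λ_R types (one raw grammar; 𝕋 = WF, 𝕋_R = IsRec)

infixr 7 _⇒_
infixl 8 _∩_ _+ᵣ_

data Ty : Set where
  atom  : Atom → Ty
  ω     : Ty
  _⇒_   : Ty → Ty → Ty
  _∩_   : Ty → Ty → Ty
  ⟨⟩    : Ty
  ⟨_∶_⟩ : Label → Ty → Ty
  _+ᵣ_  : Ty → Ty → Ty

mutual
  data WF : Ty → Set where
    atom : ∀ a → WF (atom a)
    ω    : WF ω
    _⇒_  : ∀ {σ τ} → WF σ → WF τ → WF (σ ⇒ τ)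
    _∩_  : ∀ {σ τ} → WF σ → WF τ → WF (σ ∩ τ)
    rec  : ∀ {ρ} → IsRec ρ → WF ρ

  data IsRec : Ty → Set where
    ⟨⟩   : IsRec ⟨⟩
    fld  : ∀ l {σ} → WF σ → IsRec ⟨ l ∶ σ ⟩
    _+_  : ∀ {ρ₁ ρ₂} → IsRec ρ₁ → IsRec ρ₂ → IsRec (ρ₁ +ᵣ ρ₂)
    _∩_  : ∀ {ρ₁ ρ₂} → IsRec ρ₁ → IsRec ρ₂ → IsRec (ρ₁ ∩ ρ₂)

lblT : Ty → List Label
lblT ⟨⟩ = []
lblT ⟨ l ∶ _ ⟩ = l ∷ []
lblT (ρ₁ ∩ ρ₂) = lblT ρ₁ ++ lblT ρ₂
lblT (ρ₁ +ᵣ ρ₂) = lblT ρ₁ ++ lblT ρ₂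
lblT _ = []

-- the record-type axioms stated as equations σ = τ (mutual ≤)
data REq : Ty → Ty → Set where
  +⟨⟩   : ∀ {ρ} → IsRec ρ → REq (ρ +ᵣ ⟨⟩) ρ
  ⟨⟩+   : ∀ {ρ} → IsRec ρ → REq (⟨⟩ +ᵣ ρ) ρ
  assoc : ∀ {ρ₁ ρ₂ ρ₃} → IsRec ρ₁ → IsRec ρ₂ → IsRec ρ₃ →
          REq ((ρ₁ +ᵣ ρ₂) +ᵣ ρ₃) (ρ₁ +ᵣ (ρ₂ +ᵣ ρ₃))
  ∩-+   : ∀ {ρ₁ ρ₂ ρ₃} → IsRec ρ₁ → IsRec ρ₂ → IsRec ρ₃ →
          REq ((ρ₁ ∩ ρ₂) +ᵣ ρ₃) ((ρ₁ +ᵣ ρ₃) ∩ (ρ₂ +ᵣ ρ₃))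
  over  : ∀ {l σ τ ρ} → WF σ → WF τ → IsRec ρ →
          REq (⟨ l ∶ σ ⟩ +ᵣ (⟨ l ∶ τ ⟩ ∩ ρ)) (⟨ l ∶ τ ⟩ ∩ ρ)
  swap  : ∀ {l l′ σ τ ρ} → l ≢ l′ → WF σ → WF τ → IsRec ρ →
          REq (⟨ l ∶ σ ⟩ +ᵣ (⟨ l′ ∶ τ ⟩ ∩ ρ)) (⟨ l′ ∶ τ ⟩ ∩ (⟨ l ∶ σ ⟩ +ᵣ ρ))

-- subtyping on 𝕋 (side conditions keep every related pair inside 𝕋)
infix 4 _≤_
data _≤_ : Ty → Ty → Set where
  refl    : ∀ {σ} → WF σ → σ ≤ σ
  trans   : ∀ {σ τ υ} → σ ≤ τ → τ ≤ υ → σ ≤ υ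
  ≤ω      : ∀ {σ} → WF σ → σ ≤ ω
  ω≤ω⇒ω   : ω ≤ ω ⇒ ω
  ∩-elimˡ : ∀ {σ τ} → WF σ → WF τ → σ ∩ τ ≤ σ
  ∩-elimʳ : ∀ {σ τ} → WF σ → WF τ → σ ∩ τ ≤ τ
  ∩-intro : ∀ {σ τ₁ τ₂} → σ ≤ τ₁ → σ ≤ τ₂ → σ ≤ τ₁ ∩ τ₂
  ⇒-∩     : ∀ {σ τ₁ τ₂} → WF σ → WF τ₁ → WF τ₂ →
            (σ ⇒ τ₁) ∩ (σ ⇒ τ₂) ≤ σ ⇒ (τ₁ ∩ τ₂)
  ⇒-mono  : ∀ {σ₁ σ₂ τ₁ τ₂} → σ₂ ≤ σ₁ → τ₁ ≤ τ₂ → σ₁ ⇒ τ₁ ≤ σ₂ ⇒ τ₂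
  fld≤⟨⟩  : ∀ {l σ} → WF σ → ⟨ l ∶ σ ⟩ ≤ ⟨⟩
  fld-∩   : ∀ {l σ τ} → WF σ → WF τ → ⟨ l ∶ σ ⟩ ∩ ⟨ l ∶ τ ⟩ ≤ ⟨ l ∶ σ ∩ τ ⟩
  fld-mono : ∀ {l σ τ} → σ ≤ τ → ⟨ l ∶ σ ⟩ ≤ ⟨ l ∶ τ ⟩
  eq→     : ∀ {σ τ} → REq σ τ → σ ≤ τ
  eq←     : ∀ {σ τ} → REq σ τ → τ ≤ σ
  +-monoˡ : ∀ {ρ₁ ρ₂ ρ} → IsRec ρ₁ → IsRec ρ₂ → IsRec ρ →
            ρ₁ ≤ ρ₂ → ρ₁ +ᵣ ρ ≤ ρ₂ +ᵣ ρ
  -- ρ₁ = ρ₂ ⇒ ρ + ρ₁ = ρ + ρ₂ (the converse direction is the same rule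
  -- with the premises swapped)
  +-congʳ : ∀ {ρ ρ₁ ρ₂} → IsRec ρ → IsRec ρ₁ → IsRec ρ₂ →
            ρ₁ ≤ ρ₂ → ρ₂ ≤ ρ₁ → ρ +ᵣ ρ₁ ≤ ρ +ᵣ ρ₂

Record : Set

data Term : Set where
  var  : Var → Term
  lam  : Var → Term → Term
  app  : Term → Term → Term
  proj : Term → Label → Term
  rcd  : List (Label × Term) → Term
  _⊕_  : Term → List (Label × Term) → Term

Record = List (Label × Term)

lblR : Record → List Label
lblR = map proj₁

data WFTerm : Term → Set where
  var  : ∀ x → WFTerm (var x)
  lam  : ∀ x {M} → WFTerm M → WFTerm (lam x M)
  app  : ∀ {M N} → WFTerm M → WFTerm N → WFTerm (app M N)
  proj : ∀ {M} l → WFTerm M → WFTerm (proj M l)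
  rcd  : ∀ {R} → Unique (lblR R) → All (WFTerm ∘ proj₂) R → WFTerm (rcd R)
  _⊕_  : ∀ {M R} → WFTerm M → Unique (lblR R) → All (WFTerm ∘ proj₂) R →
         WFTerm (M ⊕ R)

mutual
  fv : Term → List Var
  fv (var x) = x ∷ []
  fv (lam x M) = filter (λ y → ¬? (y ≟ x)) (fv M)
  fv (app M N) = fv M ++ fv N
  fv (proj M l) = fv M
  fv (rcd R) = fvR R
  fv (M ⊕ R) = fv M ++ fvR R

  fvR : Record → List Var
  fvR [] = []
  fvR ((l , M) ∷ R) = fv M ++ fvR R

Closed : Term → Set
Closed M = fv M ≡ []

-- Y = λf.(λx.f(xx))(λx.f(xx))   (with f = 0, x = 1)
𝐘 : Term
𝐘 = lam 0 (app W W)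
  where W = lam 1 (app (var 0) (app (var 1) (var 1)))

IsClass : Term → Set
IsClass C = Closed C × WFTerm C ×
  Σ Var λ myClass → Σ Var λ state → Σ Record λ R →
    myClass ≢ state × C ≡ app 𝐘 (lam myClass (lam state (rcd R)))

IsMixin : Term → Record → Set
IsMixin M R = Closed M × WFTerm M ×
  Σ Var λ argClass → Σ Var λ myClass → Σ Var λ state →
    argClass ≢ myClass × argClass ≢ state × myClass ≢ state ×
    M ≡ lam argClass (app 𝐘 (lam myClass (lam state (app (var argClass) (var state) ⊕ R))))

Basis : Set
Basis = List (Var × Ty)

_,,_ : Basis → Var × Ty → Basis
Γ ,, (x , σ) = (x , σ) ∷ filter (λ p → ¬? (proj₁ p ≟ x)) Γ

infix 3 _⊢_∶_
data _⊢_∶_ : Basis → Term → Ty → Set where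
  var  : ∀ {Γ x σ} → WF σ → (x , σ) ∈ Γ → Γ ⊢ var x ∶ σ
  lam  : ∀ {Γ x M σ τ} → WF σ → (Γ ,, (x , σ)) ⊢ M ∶ τ → Γ ⊢ lam x M ∶ σ ⇒ τ
  app  : ∀ {Γ M N σ τ} → Γ ⊢ M ∶ σ ⇒ τ → Γ ⊢ N ∶ σ → Γ ⊢ app M N ∶ τ
  ∩I   : ∀ {Γ M σ τ} → Γ ⊢ M ∶ σ → Γ ⊢ M ∶ τ → Γ ⊢ M ∶ σ ∩ τ
  ωI   : ∀ {Γ M} → Γ ⊢ M ∶ ω
  sub  : ∀ {Γ M σ τ} → Γ ⊢ M ∶ σ → σ ≤ τ → Γ ⊢ M ∶ τ
  rcd⟨⟩ : ∀ {Γ R} → Γ ⊢ rcd R ∶ ⟨⟩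
  rcdI : ∀ {Γ R l N σ} → (l , N) ∈ R → Γ ⊢ N ∶ σ → Γ ⊢ rcd R ∶ ⟨ l ∶ σ ⟩
  projE : ∀ {Γ M l σ} → Γ ⊢ M ∶ ⟨ l ∶ σ ⟩ → Γ ⊢ proj M l ∶ σ
  ⊕I   : ∀ {Γ M R ρ₁ ρ₂} → IsRec ρ₁ → IsRec ρ₂ →
         Γ ⊢ M ∶ ρ₁ → Γ ⊢ rcd R ∶ ρ₂ → SameSet (lblR R) (lblT ρ₂) →
         Γ ⊢ M ⊕ R ∶ ρ₁ +ᵣ ρ₂

data Ctor : Set where
  recC : Ctor
  labC : Label → Ctor

infixr 7 _⇒ᵇ_
infixl 8 _∩ᵇ_

data BTy : Set where
  batom : Atom → BTy
  tv    : TVar → BTy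
  bω    : BTy
  _⇒ᵇ_  : BTy → BTy → BTy
  _∩ᵇ_  : BTy → BTy → BTy
  con   : Ctor → BTy → BTy

CtorOK : List Label → Ctor → Set
CtorOK 𝓛 recC = ⊤
CtorOK 𝓛 (labC l) = l ∈ 𝓛

data InL (𝓛 : List Label) : BTy → Set where
  batom : ∀ a → InL 𝓛 (batom a)
  tv    : ∀ α → InL 𝓛 (tv α)
  bω    : InL 𝓛 bω
  _⇒ᵇ_  : ∀ {σ τ} → InL 𝓛 σ → InL 𝓛 τ → InL 𝓛 (σ ⇒ᵇ τ)
  _∩ᵇ_  : ∀ {σ τ} → InL 𝓛 σ → InL 𝓛 τ → InL 𝓛 (σ ∩ᵇ τ)
  con   : ∀ {c τ} → CtorOK 𝓛 c → InL 𝓛 τ → InL 𝓛 (con c τ)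

level : BTy → ℕ
level (batom _) = 0
level (tv _) = 0
level bω = 0
level (σ ⇒ᵇ τ) = suc (level σ ⊔ level τ)
level (σ ∩ᵇ τ) = level σ ⊔ level τ
level (con _ τ) = suc (level τ)

infix 4 _⊢ᶜ_≤_
data _⊢ᶜ_≤_ (𝓛 : List Label) : BTy → BTy → Set where
  refl    : ∀ {σ} → InL 𝓛 σ → 𝓛 ⊢ᶜ σ ≤ σ
  trans   : ∀ {σ τ υ} → 𝓛 ⊢ᶜ σ ≤ τ → 𝓛 ⊢ᶜ τ ≤ υ → 𝓛 ⊢ᶜ σ ≤ υ
  ≤ω      : ∀ {σ} → InL 𝓛 σ → 𝓛 ⊢ᶜ σ ≤ bω
  ω≤ω⇒ω   : 𝓛 ⊢ᶜ bω ≤ bω ⇒ᵇ bω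
  ∩-elimˡ : ∀ {σ τ} → InL 𝓛 σ → InL 𝓛 τ → 𝓛 ⊢ᶜ σ ∩ᵇ τ ≤ σ
  ∩-elimʳ : ∀ {σ τ} → InL 𝓛 σ → InL 𝓛 τ → 𝓛 ⊢ᶜ σ ∩ᵇ τ ≤ τ
  ∩-intro : ∀ {σ τ₁ τ₂} → 𝓛 ⊢ᶜ σ ≤ τ₁ → 𝓛 ⊢ᶜ σ ≤ τ₂ → 𝓛 ⊢ᶜ σ ≤ τ₁ ∩ᵇ τ₂
  ⇒-∩     : ∀ {σ τ₁ τ₂} → InL 𝓛 σ → InL 𝓛 τ₁ → InL 𝓛 τ₂ →
            𝓛 ⊢ᶜ (σ ⇒ᵇ τ₁) ∩ᵇ (σ ⇒ᵇ τ₂) ≤ σ ⇒ᵇ (τ₁ ∩ᵇ τ₂)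
  ⇒-mono  : ∀ {σ₁ σ₂ τ₁ τ₂} → 𝓛 ⊢ᶜ σ₂ ≤ σ₁ → 𝓛 ⊢ᶜ τ₁ ≤ τ₂ →
            𝓛 ⊢ᶜ σ₁ ⇒ᵇ τ₁ ≤ σ₂ ⇒ᵇ τ₂
  con-mono : ∀ {c τ₁ τ₂} → CtorOK 𝓛 c → 𝓛 ⊢ᶜ τ₁ ≤ τ₂ → 𝓛 ⊢ᶜ con c τ₁ ≤ con c τ₂
  con-∩   : ∀ {c τ₁ τ₂} → CtorOK 𝓛 c → InL 𝓛 τ₁ → InL 𝓛 τ₂ →
            𝓛 ⊢ᶜ con c τ₁ ∩ᵇ con c τ₂ ≤ con c (τ₁ ∩ᵇ τ₂)

-- substitutions (identity outside their domain, so level(S) ≤ k iff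
-- every S α has level ≤ k)
Subst : Set
Subst = TVar → BTy

_⟪_⟫ : BTy → Subst → BTy
batom a ⟪ S ⟫ = batom a
tv α ⟪ S ⟫ = S α
bω ⟪ S ⟫ = bω
(σ ⇒ᵇ τ) ⟪ S ⟫ = (σ ⟪ S ⟫) ⇒ᵇ (τ ⟪ S ⟫)
(σ ∩ᵇ τ) ⟪ S ⟫ = (σ ⟪ S ⟫) ∩ᵇ (τ ⟪ S ⟫)
con c τ ⟪ S ⟫ = con c (τ ⟪ S ⟫)

infixl 9 _·_
data CTerm : Set where
  cst : Term → CTerm
  _·_ : CTerm → CTerm → CTerm

Repository : Set
Repository = List (Term × BTy)

data BCL (𝓛 : List Label) (Δ : Repository) (k : ℕ) : CTerm → BTy → Set where
  ax   : ∀ {C τ} → (C , τ) ∈ Δ → (S : Subst) →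
         (∀ α → level (S α) ≤ℕ k) → (∀ α → InL 𝓛 (S α)) →
         BCL 𝓛 Δ k (cst C) (τ ⟪ S ⟫)
  app  : ∀ {E E′ σ τ} → BCL 𝓛 Δ k E (σ ⇒ᵇ τ) → BCL 𝓛 Δ k E′ σ → BCL 𝓛 Δ k (E · E′) τ
  ∩I   : ∀ {E σ τ} → BCL 𝓛 Δ k E σ → BCL 𝓛 Δ k E τ → BCL 𝓛 Δ k E (σ ∩ᵇ τ)
  sub  : ∀ {E σ τ} → BCL 𝓛 Δ k E σ → 𝓛 ⊢ᶜ σ ≤ τ → BCL 𝓛 Δ k E τ

⟦_⟧ : Ty → List Label → Maybe BTy
⟦ atom a ⟧ 𝓛 = just (batom a)
⟦ ω ⟧ 𝓛 = just bω
⟦ σ ⇒ τ ⟧ 𝓛 with ⟦ σ ⟧ 𝓛 | ⟦ τ ⟧ 𝓛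
... | just s | just t = just (s ⇒ᵇ t)
... | _ | _ = nothing
⟦ σ ∩ τ ⟧ 𝓛 with ⟦ σ ⟧ 𝓛 | ⟦ τ ⟧ 𝓛
... | just s | just t = just (s ∩ᵇ t)
... | _ | _ = nothing
⟦ ⟨⟩ ⟧ 𝓛 = just (con recC bω)
⟦ ⟨ l ∶ σ ⟩ ⟧ 𝓛 with l ∈? 𝓛 | ⟦ σ ⟧ 𝓛
... | yes _ | just t = just (con recC (con (labC l) t))
... | _ | _ = nothing
⟦ _ +ᵣ _ ⟧ 𝓛 = nothing

record Class (𝓛 : List Label) : Set where
  field
    term   : Term
    σ ρ    : Ty
    ⟦σ⟧ ⟦ρ⟧ : BTy
    isClass : IsClass term
    wfσ    : WF σ
    recρ   : IsRec ρ
    trσ    : ⟦ σ ⟧ 𝓛 ≡ just ⟦σ⟧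
    trρ    : ⟦ ρ ⟧ 𝓛 ≡ just ⟦ρ⟧
    typed  : [] ⊢ term ∶ σ ⇒ ρ

record Mixin (𝓛 : List Label) : Set where
  field
    term   : Term
    R      : Record
    σ ρ¹ ρ² : Ty
    ⟦σ⟧ ⟦ρ¹⟧ ⟦ρ²⟧ : BTy
    isMixin : IsMixin term R
    wfσ    : WF σ
    recρ¹  : IsRec ρ¹
    recρ²  : IsRec ρ²
    trσ    : ⟦ σ ⟧ 𝓛 ≡ just ⟦σ⟧
    trρ¹   : ⟦ ρ¹ ⟧ 𝓛 ≡ just ⟦ρ¹⟧
    trρ²   : ⟦ ρ² ⟧ 𝓛 ≡ just ⟦ρ²⟧
    typed  : ∀ ρ → IsRec ρ → [] ⊢ term ∶ (σ ⇒ ρ ∩ ρ¹) ⇒ (σ ⇒ ρ +ᵣ ρ²)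
    lblR≡  : SameSet (lblT ρ²) (lblR R)
    L⊆𝓛    : ∀ l → l ∈ lblT ρ² → l ∈ 𝓛
    L≠∅    : ∃ λ l → l ∈ lblT ρ²

  L : List Label
  L = lblT ρ²

  tyFor : Ty → Ty
  tyFor ρ = (σ ⇒ ρ ∩ ρ¹) ⇒ (σ ⇒ ρ +ᵣ ρ²)

record Setting : Set where
  field
    𝓛      : List Label
    nC nM  : ℕ
    classes : Fin nC → Class 𝓛
    mixins  : Fin nM → Mixin 𝓛
    -- 𝒞 and 𝓜 are sets of terms: the enumerations are repetition-free
    classes-inj : Injective _≡_ _≡_ (Class.term ∘ classes)
    mixins-inj  : Injective _≡_ _≡_ (Mixin.term ∘ mixins)

ValidRec : List Label → Ty → Set
ValidRec 𝓛 ρ = IsRec ρ × ∃ λ t → ⟦ ρ ⟧ 𝓛 ≡ just t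

mixinBTy : (𝓛 : List Label) → Mixin 𝓛 → BTy
mixinBTy 𝓛 m =
  foldr (λ l acc → acc ∩ᵇ ((⟦σ⟧ ⇒ᵇ rl l) ⇒ᵇ (⟦σ⟧ ⇒ᵇ rl l)))
        ((⟦σ⟧ ⇒ᵇ ⟦ρ¹⟧) ⇒ᵇ (⟦σ⟧ ⇒ᵇ ⟦ρ²⟧))
        (filter (λ l → l ∉? L) 𝓛)
  where
  open Mixin m
  -- rec(l(α_l)) with α_l the type variable number l (distinct for distinct l)
  rl : Label → BTy
  rl l = con recC (con (labC l) (tv l))

module _ (S : Setting) where
  open Setting S

  Δ : Repository
  Δ = map (λ c → Class.term (classes c) , (Class.⟦σ⟧ (classes c) ⇒ᵇ Class.⟦ρ⟧ (classes c))) (allFin nC)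
      ++ map (λ m → Mixin.term (mixins m) , mixinBTy 𝓛 (mixins m)) (allFin nM)

  kLevel : BTy → ℕ
  kLevel t = foldr _⊔_ (level t)
    (map (λ c → level (Class.⟦ρ⟧ (classes c))) (allFin nC)
     ++ map (λ m → level (Mixin.⟦ρ²⟧ (mixins m))) (allFin nM))

  record Naming : Set where
    field
      xC : Fin nC → Var
      xM : Fin nM → Ty → Var
      xC-inj : ∀ c c′ → xC c ≡ xC c′ → c ≡ c′
      xM-inj : ∀ m m′ ρ ρ′ → ValidRec 𝓛 ρ → ValidRec 𝓛 ρ′ →
               xM m ρ ≡ xM m′ ρ′ → m ≡ m′ × ρ ≡ ρ′
      xC≢xM  : ∀ c m ρ → ValidRec 𝓛 ρ → xC c ≢ xM m ρ

  AllowedBasis : Naming → Basis → Set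
  AllowedBasis N Γ = ∀ {x τ} → (x , τ) ∈ Γ →
      (∃ λ c → x ≡ Naming.xC N c × τ ≡ Class.σ (classes c) ⇒ Class.ρ (classes c))
    ⊎ (∃ λ m → ∃ λ ρ → ValidRec 𝓛 ρ × x ≡ Naming.xM N m ρ × τ ≡ Mixin.tyFor (mixins m) ρ)

-- x ▷ f₁ ▷ ⋯ ▷ fₙ  =  fₙ (⋯ (f₁ x) ⋯)
pipe : Term → List Term → Term
pipe = foldl (λ acc f → app f acc)

pipeᶜ : CTerm → List CTerm → CTerm
pipeᶜ = foldl (λ acc f → f · acc)

module Submission where

-- A logical-relations argument.  A BCL type t realizes a Λ_R type τ when, by
-- induction on τ, arrows send realizers to realizers, every field ⟨l ∶ σ⟩ is
-- witnessed by some t ≤ rec(l(u)) with u realizing σ, and ρ₁ + ρ₂ is realized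
-- by realizing ρ₂ together with ρ₁ minus the labels of ρ₂.  Realizability is
-- closed under Λ_R subtyping, ⟦τ⟧ realizes τ, and every realizer of τ lies
-- below ⟦τ⟧.  The class combinator has a realizing BCL type, and a mixin M
-- turns a realizer of σ_M → ρ ∩ ρ¹_M into one of σ_M → ρ + ρ²_M: a field
-- l ∉ L_M of ρ with witness u is carried through M by instantiating α_l := u,
-- which respects the level bound k because u comes from the output type of a
-- class or mixin.  Following the pipe C ▷ M₁ ▷ ⋯ ▷ Mₙ we obtain a realizer of
-- σ → ρ, which lies below ⟦σ → ρ⟧.

open import Defs
open import Data.Empty using (⊥)
open import Data.Fin using (Fin)
open import Data.List using (List; []; _∷_; _++_; map; foldr; filter; allFin)
open import Data.List.Membership.Propositional using (_∈_; _∉_)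
open import Data.List.Membership.Propositional.Properties
  using (∈-++⁺ˡ; ∈-++⁺ʳ; ∈-++⁻; ∈-map⁺; ∈-allFin; ∈-filter⁺; ∈-filter⁻)
open import Data.List.Properties using (++-assoc; ++-identityʳ)
open import Data.List.Relation.Binary.Permutation.Propositional using (↭-swap; ↭-refl)
open import Data.List.Relation.Binary.Permutation.Propositional.Properties using (shifts)
open import Data.List.Relation.Binary.Subset.Propositional using (_⊆_)
open import Data.List.Relation.Binary.Subset.Propositional.Properties
  using (⊆-reflexive; ⊆-reflexive-↭; xs⊆x∷xs; xs⊆xs++ys; xs⊆ys++xs; ++⁺; ++⁺ˡ; ++⁺ʳ)
open import Data.List.Relation.Unary.All using (All; []; _∷_; tabulate)
open import Data.List.Relation.Unary.Any using (here; there)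
open import Data.List.Relation.Unary.Unique.Propositional using (Unique)
open import Data.Maybe using (just; nothing)
open import Data.Nat using (ℕ; _⊔_; z≤n) renaming (_≤_ to _≤ℕ_)
open import Data.Nat.Properties using (_≟_; ≤-trans; ⊔-lub; m≤m⊔n; m≤n⊔m; n≤1+n)
open import Data.List.Membership.DecPropositional _≟_ using (_∈?_; _∉?_)
open import Data.Product using (Σ; _×_; _,_; proj₁; proj₂)
open import Data.Sum using (_⊎_; inj₁; inj₂; [_,_])
open import Data.Unit using (⊤; tt)
open import Function using (_∘_; const)
open import Relation.Nullary using (yes; no)
open import Relation.Binary.PropositionalEquality using (_≡_; refl; sym; cong; cong₂; subst)

++-⊆ : ∀ {A : Set} {xs ys zs : List A} → xs ⊆ zs → ys ⊆ zs → xs ++ ys ⊆ zs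
++-⊆ {xs = xs} xs⊆zs ys⊆zs = [ xs⊆zs , ys⊆zs ] ∘ ∈-++⁻ xs

REq⇒lblT⊇ : ∀ {σ τ} → REq σ τ → lblT τ ⊆ lblT σ
REq⇒lblT⊇ (+⟨⟩ {ρ} _) = xs⊆xs++ys (lblT ρ) []
REq⇒lblT⊇ (⟨⟩+ _) = λ p → p
REq⇒lblT⊇ (assoc {ρ₁} {ρ₂} {ρ₃} _ _ _) = ⊆-reflexive (sym (++-assoc (lblT ρ₁) (lblT ρ₂) (lblT ρ₃)))
REq⇒lblT⊇ (∩-+ {ρ₁} {ρ₂} {ρ₃} _ _ _) =
  ++-⊆ (++⁺ˡ (lblT ρ₃) (xs⊆xs++ys (lblT ρ₁) (lblT ρ₂)))
       (++⁺ˡ (lblT ρ₃) (xs⊆ys++xs (lblT ρ₂) (lblT ρ₁)))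
REq⇒lblT⊇ (over _ _ _) = xs⊆x∷xs _ _
REq⇒lblT⊇ (swap _ _ _ _) = ⊆-reflexive-↭ (↭-swap _ _ ↭-refl)

REq⇒lblT⊆ : ∀ {σ τ} → REq σ τ → lblT σ ⊆ lblT τ
REq⇒lblT⊆ (+⟨⟩ {ρ} _) = ⊆-reflexive (++-identityʳ (lblT ρ))
REq⇒lblT⊆ (⟨⟩+ _) = λ p → p
REq⇒lblT⊆ (assoc {ρ₁} {ρ₂} {ρ₃} _ _ _) = ⊆-reflexive (++-assoc (lblT ρ₁) (lblT ρ₂) (lblT ρ₃))
REq⇒lblT⊆ (∩-+ {ρ₁} {ρ₂} {ρ₃} _ _ _) =
  ++-⊆ (++⁺ (xs⊆xs++ys (lblT ρ₁) (lblT ρ₃)) (xs⊆xs++ys (lblT ρ₂) (lblT ρ₃)))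
       (xs⊆xs++ys (lblT ρ₁ ++ lblT ρ₃) _ ∘ xs⊆ys++xs (lblT ρ₃) (lblT ρ₁))
REq⇒lblT⊆ (over _ _ _) = λ { (here p) → here p ; (there p) → p }
REq⇒lblT⊆ (swap _ _ _ _) = ⊆-reflexive-↭ (↭-swap _ _ ↭-refl)

REq-IsRec : ∀ {σ τ} → REq σ τ → IsRec σ × IsRec τ
REq-IsRec (+⟨⟩ r) = r + ⟨⟩ , r
REq-IsRec (⟨⟩+ r) = ⟨⟩ + r , r
REq-IsRec (assoc r₁ r₂ r₃) = (r₁ + r₂) + r₃ , r₁ + (r₂ + r₃)
REq-IsRec (∩-+ r₁ r₂ r₃) = (r₁ ∩ r₂) + r₃ , (r₁ + r₃) ∩ (r₂ + r₃)
REq-IsRec (over wσ wτ r) = fld _ wσ + (fld _ wτ ∩ r) , fld _ wτ ∩ r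
REq-IsRec (swap _ wσ wτ r) = fld _ wσ + (fld _ wτ ∩ r) , fld _ wτ ∩ (fld _ wσ + r)

≤⇒lblT⊇ : ∀ {σ τ} → σ ≤ τ → lblT τ ⊆ lblT σ
≤⇒lblT⊇ (refl _) = λ p → p
≤⇒lblT⊇ (trans σ≤τ τ≤υ) = ≤⇒lblT⊇ σ≤τ ∘ ≤⇒lblT⊇ τ≤υ
≤⇒lblT⊇ (≤ω _) = λ ()
≤⇒lblT⊇ ω≤ω⇒ω = λ ()
≤⇒lblT⊇ (∩-elimˡ {σ} {τ} _ _) = xs⊆xs++ys (lblT σ) (lblT τ)
≤⇒lblT⊇ (∩-elimʳ {σ} {τ} _ _) = xs⊆ys++xs (lblT τ) (lblT σ)
≤⇒lblT⊇ (∩-intro σ≤τ₁ σ≤τ₂) = ++-⊆ (≤⇒lblT⊇ σ≤τ₁) (≤⇒lblT⊇ σ≤τ₂)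
≤⇒lblT⊇ (⇒-∩ _ _ _) = λ ()
≤⇒lblT⊇ (⇒-mono _ _) = λ ()
≤⇒lblT⊇ (fld≤⟨⟩ _) = λ ()
≤⇒lblT⊇ (fld-∩ {l} _ _) = xs⊆xs++ys (l ∷ []) _
≤⇒lblT⊇ (fld-mono _) = λ p → p
≤⇒lblT⊇ (eq→ r) = REq⇒lblT⊇ r
≤⇒lblT⊇ (eq← r) = REq⇒lblT⊆ r
≤⇒lblT⊇ (+-monoˡ {ρ = ρ} _ _ _ ρ₁≤ρ₂) = ++⁺ˡ (lblT ρ) (≤⇒lblT⊇ ρ₁≤ρ₂)
≤⇒lblT⊇ (+-congʳ {ρ} _ _ _ ρ₁≤ρ₂ _) = ++⁺ʳ (lblT ρ) (≤⇒lblT⊇ ρ₁≤ρ₂)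

recᵇ : BTy → BTy
recᵇ = con recC

fldᵇ : Label → BTy → BTy
fldᵇ l u = con recC (con (labC l) u)

InL-⟪⟫ : ∀ {𝓛 t} {S : Subst} → InL 𝓛 t → (∀ α → InL 𝓛 (S α)) → InL 𝓛 (t ⟪ S ⟫)
InL-⟪⟫ (batom a) _ = batom a
InL-⟪⟫ (tv α) InL-S = InL-S α
InL-⟪⟫ bω _ = bω
InL-⟪⟫ (s ⇒ᵇ t) InL-S = InL-⟪⟫ s InL-S ⇒ᵇ InL-⟪⟫ t InL-S
InL-⟪⟫ (s ∩ᵇ t) InL-S = InL-⟪⟫ s InL-S ∩ᵇ InL-⟪⟫ t InL-S
InL-⟪⟫ (con c t) InL-S = con c (InL-⟪⟫ t InL-S)

⋂ᵇ : (Label → BTy) → BTy → List Label → BTy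
⋂ᵇ f b = foldr (λ l acc → acc ∩ᵇ f l) b

module _ {𝓛 : List Label} {f : Label → BTy} {b : BTy} where

  InL-⋂ᵇ : ∀ {ls} → InL 𝓛 b → All (InL 𝓛 ∘ f) ls → InL 𝓛 (⋂ᵇ f b ls)
  InL-⋂ᵇ ib [] = ib
  InL-⋂ᵇ ib (if ∷ ifs) = InL-⋂ᵇ ib ifs ∩ᵇ if

  module _ {S : Subst} (InL-S : ∀ α → InL 𝓛 (S α)) (ib : InL 𝓛 b) where

    ⋂ᵇ-⟪⟫-≤-base : ∀ {ls} → All (InL 𝓛 ∘ f) ls → 𝓛 ⊢ᶜ ⋂ᵇ f b ls ⟪ S ⟫ ≤ b ⟪ S ⟫
    ⋂ᵇ-⟪⟫-≤-base [] = refl (InL-⟪⟫ ib InL-S)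
    ⋂ᵇ-⟪⟫-≤-base (if ∷ ifs) =
      trans (∩-elimˡ (InL-⟪⟫ (InL-⋂ᵇ ib ifs) InL-S) (InL-⟪⟫ if InL-S)) (⋂ᵇ-⟪⟫-≤-base ifs)

    ⋂ᵇ-⟪⟫-≤-∈ : ∀ {l ls} → All (InL 𝓛 ∘ f) ls → l ∈ ls → 𝓛 ⊢ᶜ ⋂ᵇ f b ls ⟪ S ⟫ ≤ f l ⟪ S ⟫
    ⋂ᵇ-⟪⟫-≤-∈ (if ∷ ifs) (here refl) = ∩-elimʳ (InL-⟪⟫ (InL-⋂ᵇ ib ifs) InL-S) (InL-⟪⟫ if InL-S)
    ⋂ᵇ-⟪⟫-≤-∈ (if ∷ ifs) (there l∈ls) =
      trans (∩-elimˡ (InL-⟪⟫ (InL-⋂ᵇ ib ifs) InL-S) (InL-⟪⟫ if InL-S)) (⋂ᵇ-⟪⟫-≤-∈ ifs l∈ls)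

module Translation (𝓛 : List Label) where

  data Translation : Ty → BTy → Set where
    atom : ∀ a → Translation (atom a) (batom a)
    ω    : Translation ω bω
    _⇒_  : ∀ {σ τ s t} → Translation σ s → Translation τ t → Translation (σ ⇒ τ) (s ⇒ᵇ t)
    _∩_  : ∀ {σ τ s t} → Translation σ s → Translation τ t → Translation (σ ∩ τ) (s ∩ᵇ t)
    ⟨⟩   : Translation ⟨⟩ (recᵇ bω)
    fld  : ∀ {l σ s} → l ∈ 𝓛 → Translation σ s → Translation ⟨ l ∶ σ ⟩ (fldᵇ l s)

  translation : ∀ τ {t} → ⟦ τ ⟧ 𝓛 ≡ just t → Translation τ t
  translation (atom a) refl = atom a
  translation ω refl = ω
  translation (σ ⇒ τ) eq with ⟦ σ ⟧ 𝓛 in eqσ | ⟦ τ ⟧ 𝓛 in eqτ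
  translation (σ ⇒ τ) refl | just _ | just _ = translation σ eqσ ⇒ translation τ eqτ
  translation (σ ⇒ τ) () | just _ | nothing
  translation (σ ⇒ τ) () | nothing | _
  translation (σ ∩ τ) eq with ⟦ σ ⟧ 𝓛 in eqσ | ⟦ τ ⟧ 𝓛 in eqτ
  translation (σ ∩ τ) refl | just _ | just _ = translation σ eqσ ∩ translation τ eqτ
  translation (σ ∩ τ) () | just _ | nothing
  translation (σ ∩ τ) () | nothing | _
  translation ⟨⟩ refl = ⟨⟩
  translation ⟨ l ∶ σ ⟩ eq with l ∈? 𝓛 | ⟦ σ ⟧ 𝓛 in eqσ
  translation ⟨ l ∶ σ ⟩ refl | yes l∈𝓛 | just _ = fld l∈𝓛 (translation σ eqσ)
  translation ⟨ l ∶ σ ⟩ () | yes _ | nothing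
  translation ⟨ l ∶ σ ⟩ () | no _ | _
  translation (_ +ᵣ _) ()

  Translation-InL : ∀ {τ t} → Translation τ t → InL 𝓛 t
  Translation-InL (atom a) = batom a
  Translation-InL ω = bω
  Translation-InL (σ ⇒ τ) = Translation-InL σ ⇒ᵇ Translation-InL τ
  Translation-InL (σ ∩ τ) = Translation-InL σ ∩ᵇ Translation-InL τ
  Translation-InL ⟨⟩ = con tt bω
  Translation-InL (fld l∈𝓛 σ) = con tt (con l∈𝓛 (Translation-InL σ))

  Translation-⟪⟫ : ∀ {τ t} → Translation τ t → ∀ S → t ⟪ S ⟫ ≡ t
  Translation-⟪⟫ (atom a) S = refl
  Translation-⟪⟫ ω S = refl
  Translation-⟪⟫ (σ ⇒ τ) S = cong₂ _⇒ᵇ_ (Translation-⟪⟫ σ S) (Translation-⟪⟫ τ S)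
  Translation-⟪⟫ (σ ∩ τ) S = cong₂ _∩ᵇ_ (Translation-⟪⟫ σ S) (Translation-⟪⟫ τ S)
  Translation-⟪⟫ ⟨⟩ S = refl
  Translation-⟪⟫ (fld _ σ) S = cong (fldᵇ _) (Translation-⟪⟫ σ S)

  Translation-≤rec : ∀ {ρ t} → Translation ρ t → IsRec ρ → 𝓛 ⊢ᶜ t ≤ recᵇ bω
  Translation-≤rec ⟨⟩ _ = refl (con tt bω)
  Translation-≤rec (fld l∈𝓛 σ) _ = con-mono tt (≤ω (con l∈𝓛 (Translation-InL σ)))
  Translation-≤rec (ρ₁ ∩ ρ₂) (rec₁ ∩ _) =
    trans (∩-elimˡ (Translation-InL ρ₁) (Translation-InL ρ₂)) (Translation-≤rec ρ₁ rec₁)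

module Realizability (𝓛 : List Label) (K : ℕ) where
  open Translation 𝓛

  infix 4 _≼_
  _≼_ : BTy → BTy → Set
  s ≼ t = 𝓛 ⊢ᶜ s ≤ t

  -- In bounded mode every field witness has level ≤ K, so that it may
  -- instantiate the type variable α_l of a mixin in BCL_K.
  data Mode : Set where
    bounded free : Mode

  WithinLevel : Mode → BTy → Set
  WithinLevel bounded u = level u ≤ℕ K
  WithinLevel free u = ⊤

  WithinLevel-≤ : ∀ m {u v} → level u ≤ℕ level v → WithinLevel m v → WithinLevel m u
  WithinLevel-≤ bounded u≤v v≤K = ≤-trans u≤v v≤K
  WithinLevel-≤ free _ _ = tt

  WithinLevel-∩ : ∀ m {u v} → WithinLevel m u → WithinLevel m v → WithinLevel m (u ∩ᵇ v)
  WithinLevel-∩ bounded = ⊔-lub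
  WithinLevel-∩ free _ _ = tt

  -- Fields whose label is in X are exempt: they are overridden by the right
  -- summand of an enclosing +.
  Realizes : Mode → List Label → Ty → BTy → Set
  Realizes m X (atom a) t = t ≼ batom a
  Realizes m X ω t = ⊤
  Realizes m X (σ ⇒ τ) t = ∀ s → InL 𝓛 s → Realizes free [] σ s →
    Σ BTy λ t′ → InL 𝓛 t′ × Realizes m [] τ t′ × t ≼ s ⇒ᵇ t′
  Realizes m X (σ ∩ τ) t = Realizes m X σ t × Realizes m X τ t
  Realizes m X ⟨⟩ t = t ≼ recᵇ bω
  Realizes m X ⟨ l ∶ σ ⟩ t = t ≼ recᵇ bω × (l ∈ X ⊎
    (l ∈ 𝓛 × Σ BTy λ u → WithinLevel m u × InL 𝓛 u × Realizes free [] σ u × t ≼ fldᵇ l u))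
  Realizes m X (ρ₁ +ᵣ ρ₂) t = Realizes m (lblT ρ₂ ++ X) ρ₁ t × Realizes m X ρ₂ t

  realizes-≼ : ∀ m X τ {s t} → s ≼ t → Realizes m X τ t → Realizes m X τ s
  realizes-≼ m X (atom a) s≼t t≼a = trans s≼t t≼a
  realizes-≼ m X ω s≼t _ = tt
  realizes-≼ m X (σ ⇒ τ) s≼t f u iu ju with f u iu ju
  ... | t′ , it′ , jt′ , t≼u⇒t′ = t′ , it′ , jt′ , trans s≼t t≼u⇒t′
  realizes-≼ m X (σ ∩ τ) s≼t (jσ , jτ) = realizes-≼ m X σ s≼t jσ , realizes-≼ m X τ s≼t jτ
  realizes-≼ m X ⟨⟩ s≼t t≼rec = trans s≼t t≼rec
  realizes-≼ m X ⟨ l ∶ σ ⟩ s≼t (t≼rec , inj₁ l∈X) = trans s≼t t≼rec , inj₁ l∈X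
  realizes-≼ m X ⟨ l ∶ σ ⟩ s≼t (t≼rec , inj₂ (l∈𝓛 , u , bu , iu , ju , t≼fld)) =
    trans s≼t t≼rec , inj₂ (l∈𝓛 , u , bu , iu , ju , trans s≼t t≼fld)
  realizes-≼ m X (ρ₁ +ᵣ ρ₂) s≼t (j₁ , j₂) = realizes-≼ m _ ρ₁ s≼t j₁ , realizes-≼ m X ρ₂ s≼t j₂

  realizes-⊆ : ∀ m τ {X Y t} → X ⊆ Y → Realizes m X τ t → Realizes m Y τ t
  realizes-⊆ m (atom a) _ j = j
  realizes-⊆ m ω _ j = j
  realizes-⊆ m (σ ⇒ τ) _ j = j
  realizes-⊆ m (σ ∩ τ) X⊆Y (jσ , jτ) = realizes-⊆ m σ X⊆Y jσ , realizes-⊆ m τ X⊆Y jτ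
  realizes-⊆ m ⟨⟩ _ j = j
  realizes-⊆ m ⟨ l ∶ σ ⟩ X⊆Y (t≼rec , inj₁ l∈X) = t≼rec , inj₁ (X⊆Y l∈X)
  realizes-⊆ m ⟨ l ∶ σ ⟩ _ (t≼rec , inj₂ w) = t≼rec , inj₂ w
  realizes-⊆ m (ρ₁ +ᵣ ρ₂) X⊆Y (j₁ , j₂) =
    realizes-⊆ m ρ₁ (++⁺ʳ (lblT ρ₂) X⊆Y) j₁ , realizes-⊆ m ρ₂ X⊆Y j₂

  realizes⇒≼rec : ∀ {m X ρ t} → IsRec ρ → Realizes m X ρ t → t ≼ recᵇ bω
  realizes⇒≼rec ⟨⟩ t≼rec = t≼rec
  realizes⇒≼rec (fld l _) (t≼rec , _) = t≼rec
  realizes⇒≼rec (_ + rec₂) (_ , j₂) = realizes⇒≼rec rec₂ j₂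
  realizes⇒≼rec (rec₁ ∩ _) (j₁ , _) = realizes⇒≼rec rec₁ j₁

  realizes-REq : ∀ {σ τ} → REq σ τ → ∀ m X {t} → Realizes m X σ t → Realizes m X τ t
  realizes-REq (+⟨⟩ _) m X (j , _) = j
  realizes-REq (⟨⟩+ _) m X (_ , j) = j
  realizes-REq (assoc {ρ₁} {ρ₂} {ρ₃} _ _ _) m X ((j₁ , j₂) , j₃) =
    realizes-⊆ m ρ₁ (⊆-reflexive (sym (++-assoc (lblT ρ₂) (lblT ρ₃) X))) j₁ , j₂ , j₃
  realizes-REq (∩-+ _ _ _) m X ((j₁ , j₂) , j₃) = (j₁ , j₃) , (j₂ , j₃)
  realizes-REq (over _ _ _) m X (_ , j) = j
  realizes-REq (swap l≢l′ _ _ _) m X ((t≼rec , inj₁ (here l≡l′)) , _) with () ← l≢l′ l≡l′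
  realizes-REq (swap _ _ _ _) m X ((t≼rec , inj₁ (there l∈X)) , j′ , j) = j′ , (t≼rec , inj₁ l∈X) , j
  realizes-REq (swap _ _ _ _) m X ((t≼rec , inj₂ w) , j′ , j) = j′ , (t≼rec , inj₂ w) , j

  realizes-REq⁻ : ∀ {σ τ} → REq σ τ → ∀ m X {t} → Realizes m X τ t → Realizes m X σ t
  realizes-REq⁻ (+⟨⟩ isRec) m X j = j , realizes⇒≼rec isRec j
  realizes-REq⁻ (⟨⟩+ isRec) m X j = realizes⇒≼rec isRec j , j
  realizes-REq⁻ (assoc {ρ₁} {ρ₂} {ρ₃} _ _ _) m X (j₁ , j₂ , j₃) =
    (realizes-⊆ m ρ₁ (⊆-reflexive (++-assoc (lblT ρ₂) (lblT ρ₃) X)) j₁ , j₂) , j₃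
  realizes-REq⁻ (∩-+ _ _ _) m X ((j₁ , j₃) , (j₂ , _)) = (j₁ , j₂) , j₃
  realizes-REq⁻ (over _ _ _) m X ((t≼rec , w) , j) = (t≼rec , inj₁ (here refl)) , (t≼rec , w) , j
  realizes-REq⁻ (swap _ _ _ _) m X (j′ , (t≼rec , inj₁ l∈X) , j) = (t≼rec , inj₁ (there l∈X)) , j′ , j
  realizes-REq⁻ (swap _ _ _ _) m X (j′ , (t≼rec , inj₂ w) , j) = (t≼rec , inj₂ w) , j′ , j

  ≼fldᵇ-∩ : ∀ {l t u₁ u₂} → l ∈ 𝓛 → InL 𝓛 u₁ → InL 𝓛 u₂ →
            t ≼ fldᵇ l u₁ → t ≼ fldᵇ l u₂ → t ≼ fldᵇ l (u₁ ∩ᵇ u₂)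
  ≼fldᵇ-∩ l∈𝓛 iu₁ iu₂ t≼u₁ t≼u₂ =
    trans (∩-intro t≼u₁ t≼u₂)
          (trans (con-∩ tt (con l∈𝓛 iu₁) (con l∈𝓛 iu₂)) (con-mono tt (con-∩ l∈𝓛 iu₁ iu₂)))

  realizes-≤ : ∀ {σ τ} → σ ≤ τ → ∀ m X {t} → InL 𝓛 t → Realizes m X σ t → Realizes m X τ t
  realizes-≤ (refl _) m X _ j = j
  realizes-≤ (trans σ≤τ τ≤υ) m X it j = realizes-≤ τ≤υ m X it (realizes-≤ σ≤τ m X it j)
  realizes-≤ (≤ω _) m X _ _ = tt
  realizes-≤ ω≤ω⇒ω m X it _ s is _ =
    bω , bω , tt , trans (≤ω it) (trans ω≤ω⇒ω (⇒-mono (≤ω is) (refl bω)))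
  realizes-≤ (∩-elimˡ _ _) m X _ (j , _) = j
  realizes-≤ (∩-elimʳ _ _) m X _ (_ , j) = j
  realizes-≤ (∩-intro σ≤τ₁ σ≤τ₂) m X it j = realizes-≤ σ≤τ₁ m X it j , realizes-≤ σ≤τ₂ m X it j
  realizes-≤ (⇒-∩ {τ₁ = τ₁} {τ₂} _ _ _) m X _ (f₁ , f₂) s is js
    with f₁ s is js | f₂ s is js
  ... | t₁ , it₁ , j₁ , t≼₁ | t₂ , it₂ , j₂ , t≼₂ =
    t₁ ∩ᵇ t₂ , it₁ ∩ᵇ it₂ ,
    (realizes-≼ m [] τ₁ (∩-elimˡ it₁ it₂) j₁ , realizes-≼ m [] τ₂ (∩-elimʳ it₁ it₂) j₂) ,
    trans (∩-intro t≼₁ t≼₂) (⇒-∩ is it₁ it₂)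
  realizes-≤ (⇒-mono σ₂≤σ₁ τ₁≤τ₂) m X _ f s is js with f s is (realizes-≤ σ₂≤σ₁ free [] is js)
  ... | t′ , it′ , j′ , t≼ = t′ , it′ , realizes-≤ τ₁≤τ₂ m [] it′ j′ , t≼
  realizes-≤ (fld≤⟨⟩ _) m X _ (t≼rec , _) = t≼rec
  realizes-≤ (fld-∩ _ _) m X _ ((t≼rec , inj₁ l∈X) , _) = t≼rec , inj₁ l∈X
  realizes-≤ (fld-∩ _ _) m X _ ((t≼rec , inj₂ _) , (_ , inj₁ l∈X)) = t≼rec , inj₁ l∈X
  realizes-≤ (fld-∩ {σ = σ} {τ} _ _) m X _
    ((t≼rec , inj₂ (l∈𝓛 , u₁ , b₁ , iu₁ , j₁ , t≼₁)) , (_ , inj₂ (_ , u₂ , b₂ , iu₂ , j₂ , t≼₂))) =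
    t≼rec , inj₂ (l∈𝓛 , u₁ ∩ᵇ u₂ , WithinLevel-∩ m b₁ b₂ , iu₁ ∩ᵇ iu₂ ,
      (realizes-≼ free [] σ (∩-elimˡ iu₁ iu₂) j₁ , realizes-≼ free [] τ (∩-elimʳ iu₁ iu₂) j₂) ,
      ≼fldᵇ-∩ l∈𝓛 iu₁ iu₂ t≼₁ t≼₂)
  realizes-≤ (fld-mono _) m X _ (t≼rec , inj₁ l∈X) = t≼rec , inj₁ l∈X
  realizes-≤ (fld-mono σ≤τ) m X _ (t≼rec , inj₂ (l∈𝓛 , u , bu , iu , ju , t≼fld)) =
    t≼rec , inj₂ (l∈𝓛 , u , bu , iu , realizes-≤ σ≤τ free [] iu ju , t≼fld)
  realizes-≤ (eq→ r) m X _ j = realizes-REq r m X j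
  realizes-≤ (eq← r) m X _ j = realizes-REq⁻ r m X j
  realizes-≤ (+-monoˡ {ρ = ρ} _ _ _ ρ₁≤ρ₂) m X it (j₁ , j) =
    realizes-≤ ρ₁≤ρ₂ m (lblT ρ ++ X) it j₁ , j
  realizes-≤ (+-congʳ {ρ} _ _ _ ρ₁≤ρ₂ ρ₂≤ρ₁) m X it (j , j₁) =
    realizes-⊆ m ρ (++⁺ˡ X (≤⇒lblT⊇ ρ₂≤ρ₁)) j , realizes-≤ ρ₁≤ρ₂ m X it j₁

  mutual
    translation-realizes : ∀ m {τ t} → Translation τ t → WithinLevel m t → ∀ X → Realizes m X τ t
    translation-realizes m (atom a) _ X = refl (batom a)
    translation-realizes m ω _ X = tt
    translation-realizes m (_⇒_ {s = s} {t} tσ tτ) b X =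
      ⇒ᵇ-realizes {X = X} tσ (Translation-InL tτ)
        (translation-realizes m tτ (WithinLevel-≤ m (≤-trans (m≤n⊔m (level s) (level t)) (n≤1+n _)) b) [])
    translation-realizes m (_∩_ {σ} {τ} {s} {t} tσ tτ) b X =
      realizes-≼ m X σ (∩-elimˡ is it) (translation-realizes m tσ (WithinLevel-≤ m (m≤m⊔n _ _) b) X) ,
      realizes-≼ m X τ (∩-elimʳ is it) (translation-realizes m tτ (WithinLevel-≤ m (m≤n⊔m (level s) _) b) X)
      where
      is : InL 𝓛 s
      is = Translation-InL tσ
      it : InL 𝓛 t
      it = Translation-InL tτ
    translation-realizes m ⟨⟩ _ X = refl (con tt bω)
    translation-realizes m (fld {s = s} l∈𝓛 σ) b X =
      con-mono tt (≤ω (con l∈𝓛 (Translation-InL σ))) ,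
      inj₂ (l∈𝓛 , s , WithinLevel-≤ m (≤-trans (n≤1+n _) (n≤1+n _)) b , Translation-InL σ ,
            translation-realizes free σ tt [] , refl (Translation-InL (fld l∈𝓛 σ)))

    realizes⇒≼translation : ∀ m {τ t s} → Translation τ t → InL 𝓛 s → Realizes m [] τ s → s ≼ t
    realizes⇒≼translation m (atom a) _ s≼a = s≼a
    realizes⇒≼translation m ω is _ = ≤ω is
    realizes⇒≼translation m (_⇒_ {s = s} σ τ) _ f with f s (Translation-InL σ) (translation-realizes free σ tt [])
    ... | t′ , it′ , j′ , s≼ = trans s≼ (⇒-mono (refl (Translation-InL σ)) (realizes⇒≼translation m τ it′ j′))
    realizes⇒≼translation m (σ ∩ τ) is (jσ , jτ) =
      ∩-intro (realizes⇒≼translation m σ is jσ) (realizes⇒≼translation m τ is jτ)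
    realizes⇒≼translation m ⟨⟩ _ s≼rec = s≼rec
    realizes⇒≼translation m (fld l∈𝓛 σ) _ (_ , inj₂ (_ , u , _ , iu , ju , s≼fld)) =
      trans s≼fld (con-mono tt (con-mono l∈𝓛 (realizes⇒≼translation free σ iu ju)))

    ⇒ᵇ-realizes : ∀ {m X σ τ s t} → Translation σ s → InL 𝓛 t → Realizes m [] τ t →
                  Realizes m X (σ ⇒ τ) (s ⇒ᵇ t)
    ⇒ᵇ-realizes {t = t} σ it jt s′ is′ js′ =
      t , it , jt , ⇒-mono (realizes⇒≼translation free σ is′ js′) (refl it)

module Realizers (𝓛 : List Label) (Δ : Repository) (K : ℕ) where
  open Translation 𝓛
  open Realizability 𝓛 K

  Typable : CTerm → Set
  Typable E = Σ BTy λ t → InL 𝓛 t × BCL 𝓛 Δ K E t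

  Realizer : Ty → CTerm → Set
  Realizer τ E = Σ BTy λ t → InL 𝓛 t × BCL 𝓛 Δ K E t × Realizes bounded [] τ t

  -- A mixin has no single BCL type realizing its Λ_R type (the type of M · E
  -- depends on the field witnesses of E), so it is interpreted as a map on
  -- realizers instead.
  FunRealizer : Ty → CTerm → Set
  FunRealizer ω f = ⊤
  FunRealizer (σ ⇒ τ) f = ∀ E → Realizer σ E → Realizer τ (f · E)
  FunRealizer (σ ∩ τ) f = FunRealizer σ f × FunRealizer τ f
  FunRealizer _ f = ⊥

  realizer-typable : ∀ {τ E} → Realizer τ E → Typable E
  realizer-typable (t , it , ⊢t , _) = t , it , ⊢t

  typable-· : ∀ {f E} → Typable f → Typable E → Typable (f · E)
  typable-· (t , it , ⊢t) (s , is , ⊢s) = bω , bω , app (sub ⊢t (trans (≤ω it) ω≤ω⇒ω)) (sub ⊢s (≤ω is))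

  realizer-ω : ∀ {E} → Typable E → Realizer ω E
  realizer-ω (t , it , ⊢t) = t , it , ⊢t , tt

  realizer-≤ : ∀ {σ τ E} → σ ≤ τ → Realizer σ E → Realizer τ E
  realizer-≤ σ≤τ (t , it , ⊢t , j) = t , it , ⊢t , realizes-≤ σ≤τ bounded [] it j

  realizer-∩ : ∀ {σ τ E} → Realizer σ E → Realizer τ E → Realizer (σ ∩ τ) E
  realizer-∩ {σ} {τ} (t₁ , it₁ , ⊢t₁ , j₁) (t₂ , it₂ , ⊢t₂ , j₂) =
    t₁ ∩ᵇ t₂ , it₁ ∩ᵇ it₂ , ∩I ⊢t₁ ⊢t₂ ,
    (realizes-≼ bounded [] σ (∩-elimˡ it₁ it₂) j₁ , realizes-≼ bounded [] τ (∩-elimʳ it₁ it₂) j₂)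

  realizer⇒typing : ∀ {τ t E} → Translation τ t → Realizer τ E → BCL 𝓛 Δ K E t
  realizer⇒typing tτ (s , is , ⊢s , j) = sub ⊢s (realizes⇒≼translation bounded tτ is j)

  ¬funRealizer-rec : ∀ {ρ f} → IsRec ρ → FunRealizer ρ f → ⊥
  ¬funRealizer-rec (rec₁ ∩ _) (r₁ , _) = ¬funRealizer-rec rec₁ r₁

  funRealizer-≤ : ∀ {σ τ f} → Typable f → σ ≤ τ → FunRealizer σ f → FunRealizer τ f
  funRealizer-≤ _ (refl _) r = r
  funRealizer-≤ ⊢f (trans σ≤τ τ≤υ) r = funRealizer-≤ ⊢f τ≤υ (funRealizer-≤ ⊢f σ≤τ r)
  funRealizer-≤ _ (≤ω _) _ = tt
  funRealizer-≤ ⊢f ω≤ω⇒ω _ E rE = realizer-ω (typable-· ⊢f (realizer-typable rE))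
  funRealizer-≤ _ (∩-elimˡ _ _) (r , _) = r
  funRealizer-≤ _ (∩-elimʳ _ _) (_ , r) = r
  funRealizer-≤ ⊢f (∩-intro σ≤τ₁ σ≤τ₂) r = funRealizer-≤ ⊢f σ≤τ₁ r , funRealizer-≤ ⊢f σ≤τ₂ r
  funRealizer-≤ _ (⇒-∩ _ _ _) (r₁ , r₂) E rE = realizer-∩ (r₁ E rE) (r₂ E rE)
  funRealizer-≤ _ (⇒-mono σ₂≤σ₁ τ₁≤τ₂) r E rE = realizer-≤ τ₁≤τ₂ (r E (realizer-≤ σ₂≤σ₁ rE))
  funRealizer-≤ _ (fld≤⟨⟩ _) ()
  funRealizer-≤ _ (fld-∩ _ _) (() , _)
  funRealizer-≤ _ (fld-mono _) ()
  funRealizer-≤ _ (eq→ r) fr with () ← ¬funRealizer-rec (proj₁ (REq-IsRec r)) fr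
  funRealizer-≤ _ (eq← r) fr with () ← ¬funRealizer-rec (proj₂ (REq-IsRec r)) fr
  funRealizer-≤ _ (+-monoˡ _ _ _ _) ()
  funRealizer-≤ _ (+-congʳ _ _ _ _ _) ()

  ⇒ᵇ-∩I : ∀ {E s r₁ r₂} → InL 𝓛 s → InL 𝓛 r₁ → InL 𝓛 r₂ →
          BCL 𝓛 Δ K E (s ⇒ᵇ r₁) → BCL 𝓛 Δ K E (s ⇒ᵇ r₂) → BCL 𝓛 Δ K E (s ⇒ᵇ (r₁ ∩ᵇ r₂))
  ⇒ᵇ-∩I is ir₁ ir₂ ⊢r₁ ⊢r₂ = sub (∩I ⊢r₁ ⊢r₂) (⇒-∩ is ir₁ ir₂)

  Tracks : Basis → Term → CTerm → Set
  Tracks Γ M E = ∀ {τ} → Γ ⊢ M ∶ τ → Realizer τ E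

  module _ {Γ : Basis} where

    tracks-typable : ∀ {M E} → Tracks Γ M E → Typable E
    tracks-typable tr = realizer-typable (tr ωI)

    tracks-var : ∀ {x E} → (∀ {σ} → (x , σ) ∈ Γ → Realizer σ E) → Typable E → Tracks Γ (var x) E
    tracks-var H _ (var _ x∶σ∈Γ) = H x∶σ∈Γ
    tracks-var H ⊢E (∩I d₁ d₂) = realizer-∩ (tracks-var H ⊢E d₁) (tracks-var H ⊢E d₂)
    tracks-var H ⊢E ωI = realizer-ω ⊢E
    tracks-var H ⊢E (sub d σ≤τ) = realizer-≤ σ≤τ (tracks-var H ⊢E d)

    var-funRealizer : ∀ {x τ f} → (∀ {σ} → (x , σ) ∈ Γ → FunRealizer σ f) → Typable f →
                      Γ ⊢ var x ∶ τ → FunRealizer τ f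
    var-funRealizer H _ (var _ x∶σ∈Γ) = H x∶σ∈Γ
    var-funRealizer H ⊢f (∩I d₁ d₂) = var-funRealizer H ⊢f d₁ , var-funRealizer H ⊢f d₂
    var-funRealizer H ⊢f ωI = tt
    var-funRealizer H ⊢f (sub d σ≤τ) = funRealizer-≤ ⊢f σ≤τ (var-funRealizer H ⊢f d)

    tracks-app : ∀ {x f M E} → (∀ {σ} → (x , σ) ∈ Γ → FunRealizer σ f) → Typable f →
                 Tracks Γ M E → Tracks Γ (app (var x) M) (f · E)
    tracks-app H ⊢f tr (app d₁ d₂) = var-funRealizer H ⊢f d₁ _ (tr d₂)
    tracks-app H ⊢f tr (∩I d₁ d₂) = realizer-∩ (tracks-app H ⊢f tr d₁) (tracks-app H ⊢f tr d₂)
    tracks-app H ⊢f tr ωI = realizer-ω (typable-· ⊢f (tracks-typable tr))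
    tracks-app H ⊢f tr (sub d σ≤τ) = realizer-≤ σ≤τ (tracks-app H ⊢f tr d)

≤-foldr-⊔ : ∀ {n} b ns → n ∈ ns → n ≤ℕ foldr _⊔_ b ns
≤-foldr-⊔ b (n ∷ ns) (here refl) = m≤m⊔n n _
≤-foldr-⊔ b (m ∷ ns) (there n∈ns) = ≤-trans (≤-foldr-⊔ b ns n∈ns) (m≤n⊔m m _)

pipe-preserves : ∀ {A : Set} {P : A → Set} (R : Term → CTerm → Set) (f : A → Term) (g : A → CTerm) →
                 (∀ {a M E} → P a → R M E → R (app (f a) M) (g a · E)) →
                 ∀ {M E} as → All P as → R M E → R (pipe M (map f as)) (pipeᶜ E (map g as))
pipe-preserves R f g step [] [] r = r
pipe-preserves R f g step (a ∷ as) (pa ∷ pas) r = pipe-preserves R f g step as pas (step pa r)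

module _ (S : Setting) where
  open Setting S

  class-∈Δ : ∀ c → let C = classes c in (Class.term C , Class.⟦σ⟧ C ⇒ᵇ Class.⟦ρ⟧ C) ∈ Δ S
  class-∈Δ c = ∈-++⁺ˡ (∈-map⁺ (λ c → Class.term (classes c) , _) (∈-allFin c))

  mixin-∈Δ : ∀ m → (Mixin.term (mixins m) , mixinBTy 𝓛 (mixins m)) ∈ Δ S
  mixin-∈Δ m = ∈-++⁺ʳ _ (∈-map⁺ (λ m → Mixin.term (mixins m) , mixinBTy 𝓛 (mixins m)) (∈-allFin m))

  kLevel-class : ∀ t c → level (Class.⟦ρ⟧ (classes c)) ≤ℕ kLevel S t
  kLevel-class t c =
    ≤-foldr-⊔ (level t) _ (∈-++⁺ˡ (∈-map⁺ (λ c → level (Class.⟦ρ⟧ (classes c))) (∈-allFin c)))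

  kLevel-mixin : ∀ t m → level (Mixin.⟦ρ²⟧ (mixins m)) ≤ℕ kLevel S t
  kLevel-mixin t m =
    ≤-foldr-⊔ (level t) _ (∈-++⁺ʳ (map (λ c → level (Class.⟦ρ⟧ (classes c))) (allFin nC))
                                  (∈-map⁺ (λ m → level (Mixin.⟦ρ²⟧ (mixins m))) (∈-allFin m)))

module ClassesAndMixins (S : Setting) (K : ℕ)
  (class-level : ∀ c → level (Class.⟦ρ⟧ (Setting.classes S c)) ≤ℕ K)
  (mixin-level : ∀ m → level (Mixin.⟦ρ²⟧ (Setting.mixins S m)) ≤ℕ K) where
  open Setting S
  open Translation 𝓛
  open Realizability 𝓛 K
  open Realizers 𝓛 (Δ S) K

  infix 3 ⊢_∶_
  ⊢_∶_ : CTerm → BTy → Set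
  ⊢ E ∶ t = BCL 𝓛 (Δ S) K E t

  class-realizer : ∀ c → Realizer (Class.σ (classes c) ⇒ Class.ρ (classes c)) (cst (Class.term (classes c)))
  class-realizer c =
    ⟦σ⟧ ⇒ᵇ ⟦ρ⟧ , Translation-InL (tσ ⇒ tρ) , ⊢C ,
    ⇒ᵇ-realizes {X = []} tσ (Translation-InL tρ) (translation-realizes bounded tρ (class-level c) [])
    where
    open Class (classes c)
    tσ : Translation σ ⟦σ⟧
    tσ = translation σ trσ
    tρ : Translation ρ ⟦ρ⟧
    tρ = translation ρ trρ
    ⊢C : ⊢ cst term ∶ ⟦σ⟧ ⇒ᵇ ⟦ρ⟧
    ⊢C = subst (⊢ cst term ∶_) (Translation-⟪⟫ (tσ ⇒ tρ) tv)
               (ax (class-∈Δ S c) tv (λ _ → z≤n) tv)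

  module MixinRealizer (m : Fin nM) where
    open Mixin (mixins m)

    tσ : Translation σ ⟦σ⟧
    tσ = translation σ trσ
    tρ¹ : Translation ρ¹ ⟦ρ¹⟧
    tρ¹ = translation ρ¹ trρ¹
    tρ² : Translation ρ² ⟦ρ²⟧
    tρ² = translation ρ² trρ²

    isσ : InL 𝓛 ⟦σ⟧
    isσ = Translation-InL tσ
    iρ² : InL 𝓛 ⟦ρ²⟧
    iρ² = Translation-InL tρ²

    base : BTy
    base = (⟦σ⟧ ⇒ᵇ ⟦ρ¹⟧) ⇒ᵇ (⟦σ⟧ ⇒ᵇ ⟦ρ²⟧)

    tbase : Translation ((σ ⇒ ρ¹) ⇒ (σ ⇒ ρ²)) base
    tbase = (tσ ⇒ tρ¹) ⇒ (tσ ⇒ tρ²)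

    clause : Label → BTy
    clause l = (⟦σ⟧ ⇒ᵇ fldᵇ l (tv l)) ⇒ᵇ (⟦σ⟧ ⇒ᵇ fldᵇ l (tv l))

    kept : List Label
    kept = filter (λ l → l ∉? L) 𝓛

    InL-clauses : All (InL 𝓛 ∘ clause) kept
    InL-clauses = tabulate λ l∈kept →
      let l∈𝓛 = proj₁ (∈-filter⁻ (λ l → l ∉? L) l∈kept)
      in (isσ ⇒ᵇ con tt (con l∈𝓛 (tv _))) ⇒ᵇ (isσ ⇒ᵇ con tt (con l∈𝓛 (tv _)))

    ⊢instance : ∀ {u} → InL 𝓛 u → level u ≤ℕ K → ⊢ cst term ∶ ⋂ᵇ clause base kept ⟪ const u ⟫
    ⊢instance iu u≤K = ax (mixin-∈Δ S m) (const _) (const u≤K) (const iu)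

    ⊢base : ⊢ cst term ∶ base
    ⊢base = subst (⊢ cst term ∶_) (Translation-⟪⟫ tbase (const bω))
      (sub (⊢instance bω z≤n) (⋂ᵇ-⟪⟫-≤-base (const bω) (Translation-InL tbase) InL-clauses))

    ⊢clause : ∀ {l u} → l ∈ 𝓛 → l ∉ L → InL 𝓛 u → level u ≤ℕ K →
              ⊢ cst term ∶ (⟦σ⟧ ⇒ᵇ fldᵇ l u) ⇒ᵇ (⟦σ⟧ ⇒ᵇ fldᵇ l u)
    ⊢clause {l} {u} l∈𝓛 l∉L iu u≤K =
      subst (λ s → ⊢ cst term ∶ (s ⇒ᵇ fldᵇ l u) ⇒ᵇ (s ⇒ᵇ fldᵇ l u)) (Translation-⟪⟫ tσ (const u))
        (sub (⊢instance iu u≤K)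
             (⋂ᵇ-⟪⟫-≤-∈ (const iu) (Translation-InL tbase) InL-clauses
                        (∈-filter⁺ (λ l → l ∉? L) l∈𝓛 l∉L)))

    mixin-typable : Typable (cst term)
    mixin-typable = base , Translation-InL tbase , ⊢base

    module _ {E t} (⊢E : ⊢ E ∶ ⟦σ⟧ ⇒ᵇ t) (t≼ρ¹ : t ≼ ⟦ρ¹⟧) where

      ⊢base-app : ⊢ cst term · E ∶ ⟦σ⟧ ⇒ᵇ ⟦ρ²⟧
      ⊢base-app = app ⊢base (sub ⊢E (⇒-mono (refl isσ) t≼ρ¹))

      ρ²≼rec : ⟦ρ²⟧ ≼ recᵇ bω
      ρ²≼rec = Translation-≤rec tρ² recρ²

      -- The fields of ρ that R_M does not override survive in M · E, each with
      -- the witness it has in t.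
      mixin-output : ∀ {X ρ} → IsRec ρ → Realizes bounded X ρ t →
        Σ BTy λ r → InL 𝓛 r × r ≼ ⟦ρ²⟧ × ⊢ cst term · E ∶ ⟦σ⟧ ⇒ᵇ r × Realizes bounded (L ++ X) ρ r
      mixin-output ⟨⟩ _ = ⟦ρ²⟧ , iρ² , refl iρ² , ⊢base-app , ρ²≼rec
      mixin-output {X} (fld l _) (_ , inj₁ l∈X) =
        ⟦ρ²⟧ , iρ² , refl iρ² , ⊢base-app , ρ²≼rec , inj₁ (xs⊆ys++xs X L l∈X)
      mixin-output (fld l _) (_ , inj₂ (l∈𝓛 , u , u≤K , iu , ju , t≼fld)) with l ∈? L
      ... | yes l∈L = ⟦ρ²⟧ , iρ² , refl iρ² , ⊢base-app , ρ²≼rec , inj₁ (∈-++⁺ˡ l∈L)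
      ... | no l∉L =
        ⟦ρ²⟧ ∩ᵇ fldᵇ l u , iρ² ∩ᵇ ifld , ∩-elimˡ iρ² ifld ,
        ⇒ᵇ-∩I isσ iρ² ifld ⊢base-app (app (⊢clause l∈𝓛 l∉L iu u≤K) (sub ⊢E (⇒-mono (refl isσ) t≼fld))) ,
        trans (∩-elimˡ iρ² ifld) ρ²≼rec , inj₂ (l∈𝓛 , u , u≤K , iu , ju , ∩-elimʳ iρ² ifld)
        where
        ifld : InL 𝓛 (fldᵇ l u)
        ifld = con tt (con l∈𝓛 iu)
      mixin-output {X} (_∩_ {ρ₁} {ρ₂} rec₁ rec₂) (j₁ , j₂)
        with mixin-output rec₁ j₁ | mixin-output rec₂ j₂
      ... | r₁ , ir₁ , r₁≼ , ⊢r₁ , jr₁ | r₂ , ir₂ , _ , ⊢r₂ , jr₂ =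
        r₁ ∩ᵇ r₂ , ir₁ ∩ᵇ ir₂ , trans (∩-elimˡ ir₁ ir₂) r₁≼ , ⇒ᵇ-∩I isσ ir₁ ir₂ ⊢r₁ ⊢r₂ ,
        (realizes-≼ bounded _ ρ₁ (∩-elimˡ ir₁ ir₂) jr₁ , realizes-≼ bounded _ ρ₂ (∩-elimʳ ir₁ ir₂) jr₂)
      mixin-output {X} (_+_ {ρ₁} {ρ₂} rec₁ rec₂) (j₁ , j₂)
        with mixin-output rec₁ j₁ | mixin-output rec₂ j₂
      ... | r₁ , ir₁ , r₁≼ , ⊢r₁ , jr₁ | r₂ , ir₂ , _ , ⊢r₂ , jr₂ =
        r₁ ∩ᵇ r₂ , ir₁ ∩ᵇ ir₂ , trans (∩-elimˡ ir₁ ir₂) r₁≼ , ⇒ᵇ-∩I isσ ir₁ ir₂ ⊢r₁ ⊢r₂ ,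
        (realizes-⊆ bounded ρ₁ (⊆-reflexive-↭ (shifts L (lblT ρ₂)))
           (realizes-≼ bounded _ ρ₁ (∩-elimˡ ir₁ ir₂) jr₁) ,
         realizes-≼ bounded _ ρ₂ (∩-elimʳ ir₁ ir₂) jr₂)

    mixin-funRealizer : ∀ {ρ} → IsRec ρ → FunRealizer (tyFor ρ) (cst term)
    mixin-funRealizer {ρ} isRec E (t , it , ⊢E , jE) with jE ⟦σ⟧ isσ (translation-realizes free tσ tt [])
    ... | t′ , it′ , (jρ , jρ¹) , t≼σ⇒t′
      with mixin-output (sub ⊢E t≼σ⇒t′) (realizes⇒≼translation bounded tρ¹ it′ jρ¹) isRec jρ
    ... | r , ir , r≼ρ² , ⊢r , jr =
      ⟦σ⟧ ⇒ᵇ r , isσ ⇒ᵇ ir , ⊢r ,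
      ⇒ᵇ-realizes {X = []} {τ = ρ +ᵣ ρ²} tσ ir
        (jr , realizes-≼ bounded [] ρ² r≼ρ² (translation-realizes bounded tρ² (mixin-level m) []))

  module _ (N : Naming S) {Γ : Basis} (allowed : AllowedBasis S N Γ) where
    open Naming N

    allowed-class : ∀ c {τ} → (xC c , τ) ∈ Γ → τ ≡ Class.σ (classes c) ⇒ Class.ρ (classes c)
    allowed-class c x∶τ∈Γ with allowed x∶τ∈Γ
    ... | inj₁ (c′ , xc≡xc′ , τ≡) with refl ← xC-inj c c′ xc≡xc′ = τ≡
    ... | inj₂ (m , ρ , valid , xc≡xm , _) with () ← xC≢xM c m ρ valid xc≡xm

    allowed-mixin : ∀ m {ρ τ} → ValidRec 𝓛 ρ → (xM m ρ , τ) ∈ Γ → τ ≡ Mixin.tyFor (mixins m) ρ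
    allowed-mixin m valid x∶τ∈Γ with allowed x∶τ∈Γ
    ... | inj₁ (c , xm≡xc , _) with () ← xC≢xM c m _ valid (sym xm≡xc)
    ... | inj₂ (m′ , ρ′ , valid′ , xm≡xm′ , τ≡) with refl , refl ← xM-inj m m′ _ ρ′ valid valid′ xm≡xm′ = τ≡

    tracks-class : ∀ c → Tracks Γ (var (xC c)) (cst (Class.term (classes c)))
    tracks-class c =
      tracks-var (λ x∶τ∈Γ → subst (λ τ → Realizer τ _) (sym (allowed-class c x∶τ∈Γ)) (class-realizer c))
                 (realizer-typable (class-realizer c))

    tracks-mixin : ∀ {m ρ M E} → ValidRec 𝓛 ρ → Tracks Γ M E →
                   Tracks Γ (app (var (xM m ρ)) M) (cst (Mixin.term (mixins m)) · E)
    tracks-mixin {m} valid =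
      tracks-app (λ x∶τ∈Γ → subst (λ τ → FunRealizer τ _) (sym (allowed-mixin m valid x∶τ∈Γ))
                                   (mixin-funRealizer (proj₁ valid)))
                 mixin-typable
      where open MixinRealizer m

theorem5p5 :
    (S : Setting) (N : Naming S) (Γ : Basis) →
    Unique (map proj₁ Γ) → AllowedBasis S N Γ →
    (σ ρ : Ty) → WF σ → IsRec ρ →
    (tσ tρ : BTy) → ⟦ σ ⟧ (Setting.𝓛 S) ≡ just tσ → ⟦ ρ ⟧ (Setting.𝓛 S) ≡ just tρ →
    (c : Fin (Setting.nC S)) (ms : List (Fin (Setting.nM S) × Ty)) →
    All (λ p → ValidRec (Setting.𝓛 S) (proj₂ p)) ms →
    Γ ⊢ pipe (var (Naming.xC N c)) (map (λ p → var (Naming.xM N (proj₁ p) (proj₂ p))) ms) ∶ σ ⇒ ρ →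
    BCL (Setting.𝓛 S) (Δ S) (kLevel S tρ)
      (pipeᶜ (cst (Class.term (Setting.classes S c)))
             (map (λ p → cst (Mixin.term (Setting.mixins S (proj₁ p)))) ms))
      (tσ ⇒ᵇ tρ)
theorem5p5 S N Γ _ allowed σ ρ _ _ tσ tρ ⟦σ⟧≡ ⟦ρ⟧≡ c ms valid ⊢pipe =
  realizer⇒typing (translation σ ⟦σ⟧≡ ⇒ translation ρ ⟦ρ⟧≡)
    (pipe-preserves (Tracks Γ) _ _ (tracks-mixin N allowed) ms valid (tracks-class N allowed c) ⊢pipe)
  where
  open Setting S
  open Translation 𝓛
  open Realizers 𝓛 (Δ S) (kLevel S tρ)
  open ClassesAndMixins S (kLevel S tρ) (kLevel-class S tρ) (kLevel-mixin S tρ)
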